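{- If $\vdash_{\mathsf{Gb}}\Gamma\Rightarrow\alpha$, then there exists a derivation of $\Gamma\Rightarrow\alpha$ in $\mathsf{Gb}$ such that every formula appearing in the derivation is a subformula of some formula appearing in $\Gamma\Rightarrow\alpha$.
   Context: Formulas of $\mathsf{Gb}$: variables $p$, the constant $\bot$, and $\alpha\cdot\beta$, $\alpha\backslash\beta$, $\alpha\wedge\beta$, $\alpha\vee\beta$, $\alpha\ast\beta$, $\alpha\rightarrow\beta$. Formula structures: every formula is a structure, and if $\Gamma,\Delta$ are structures so are $(\Gamma,\Delta)$ and $(\Gamma;\Delta)$. A context $\Gamma[-]$ is a structure with one designated hole; $\Gamma[\Delta]$ is the result of filling it with $\Delta$. A sequent is $\Gamma\Rightarrow\alpha$ with $\Gamma$ a structure and $\alpha$ a formula. Rules of $\mathsf{Gb}$ (premises / conclusion): $(\mathrm{Id})$ $\alpha\Rightarrow\alpha$; $(\cdot\mathrm{L})$ $\Gamma[\alpha,\beta]\Rightarrow\gamma$ / $\Gamma[\alpha\cdot\beta]\Rightarrow\gamma$; $(\cdot\mathrm{R})$ $\Gamma_1\Rightarrow\alpha$, $\Gamma_2\Rightarrow\beta$ / $\Gamma_1,\Gamma_2\Rightarrow\alpha\cdot\beta$; $(\ast\mathrm{L})$ $\Gamma[\alpha;\beta]\Rightarrow\gamma$ / $\Gamma[\alpha\ast\beta]\Rightarrow\gamma$; $(\ast\mathrm{R})$ $\Gamma_1\Rightarrow\alpha$, $\Gamma_2\Rightarrow\beta$ / $\Gamma_1;\Gamma_2\Rightarrow\alpha\ast\beta$;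 $(\backslash\mathrm{L})$ $\Delta\Rightarrow\alpha$, $\Gamma[\beta]\Rightarrow\gamma$ / $\Gamma[\Delta,\alpha\backslash\beta]\Rightarrow\gamma$; $(\backslash\mathrm{R})$ $\alpha,\Gamma\Rightarrow\beta$ / $\Gamma\Rightarrow\alpha\backslash\beta$; $(\rightarrow\mathrm{L})$ $\Delta\Rightarrow\alpha$, $\Gamma[\beta]\Rightarrow\gamma$ / $\Gamma[\Delta;\alpha\rightarrow\beta]\Rightarrow\gamma$; $(\rightarrow\mathrm{R})$ $\alpha;\Gamma\Rightarrow\beta$ / $\Gamma\Rightarrow\alpha\rightarrow\beta$; $(\wedge\mathrm{L})$ $\Gamma[\alpha]\Rightarrow\beta$ / $\Gamma[\alpha\wedge\gamma]\Rightarrow\beta$ and $\Gamma[\alpha]\Rightarrow\beta$ / $\Gamma[\gamma\wedge\alpha]\Rightarrow\beta$; $(\wedge\mathrm{R})$ $\Gamma\Rightarrow\alpha$, $\Gamma\Rightarrow\beta$ / $\Gamma\Rightarrow\alpha\wedge\beta$; $(\vee\mathrm{L})$ $\Gamma[\alpha]\Rightarrow\gamma$, $\Gamma[\beta]\Rightarrow\gamma$ / $\Gamma[\alpha\vee\beta]\Rightarrow\gamma$; $(\vee\mathrm{R})$ $\Gamma\Rightarrow\alpha$ / $\Gamma\Rightarrow\alpha\vee\beta$ and $\Gamma\Rightarrow\alpha$ / $\Gamma\Rightarrow\beta\vee\alpha$; $(\bot)$ $\Delta\Rightarrow\bot$ / $\Gamma[\Delta]\Rightarrow\alpha$; $(\mathrm{Cut})$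 $\Delta\Rightarrow\alpha$, $\Gamma[\alpha]\Rightarrow\beta$ / $\Gamma[\Delta]\Rightarrow\beta$; $(\mathrm{R}\text{ - }\bot)$ $(\Delta_1,\Delta_2);\Delta_3\Rightarrow\bot$ / $(\Delta_1,\Delta_3);\Delta_2\Rightarrow\bot$; $(\mathrm{Ex})$ $\Gamma[\Delta_1,\Delta_2]\Rightarrow\beta$ / $\Gamma[\Delta_2,\Delta_1]\Rightarrow\beta$; $(\mathrm{Ex}^;)$ $\Gamma[\Delta_1;\Delta_2]\Rightarrow\beta$ / $\Gamma[\Delta_2;\Delta_1]\Rightarrow\beta$; $(\mathrm{As}_1)$ $\Gamma[\Delta_1,(\Delta_2,\Delta_3)]\Rightarrow\beta$ / $\Gamma[(\Delta_1,\Delta_2),\Delta_3]\Rightarrow\beta$; $(\mathrm{As}_2)$ the converse of $(\mathrm{As}_1)$. -}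

module Defs where

open import Data.Nat using (ℕ)
open import Data.Product using (Σ; _×_; ∃-syntax)
open import Data.Sum using (_⊎_)
open import Relation.Binary.PropositionalEquality using (_≡_)

infixr 30 _·_ _*_
infixr 25 _∧_ _∨_
infixr 20 _∖_ _⇒_

data Fm : Set where
  var : ℕ → Fm
  ⊥   : Fm
  _·_ : Fm → Fm → Fm
  _∖_ : Fm → Fm → Fm
  _∧_ : Fm → Fm → Fm
  _∨_ : Fm → Fm → Fm
  _*_ : Fm → Fm → Fm
  _⇒_ : Fm → Fm → Fm

data Str : Set where
  fm   : Fm → Str
  _,ₛ_ : Str → Str → Str
  _⨾ₛ_ : Str → Str → Str

data Ctx : Set where
  ∙    : Ctx
  _,ₗ_ : Ctx → Str → Ctx
  _,ᵣ_ : Str → Ctx → Ctx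
  _⨾ₗ_ : Ctx → Str → Ctx
  _⨾ᵣ_ : Str → Ctx → Ctx

_[_] : Ctx → Str → Str
∙ [ Δ ] = Δ
(Γ ,ₗ S) [ Δ ] = (Γ [ Δ ]) ,ₛ S
(S ,ᵣ Γ) [ Δ ] = S ,ₛ (Γ [ Δ ])
(Γ ⨾ₗ S) [ Δ ] = (Γ [ Δ ]) ⨾ₛ S
(S ⨾ᵣ Γ) [ Δ ] = S ⨾ₛ (Γ [ Δ ])

data Gb : Str → Fm → Set where
  Id   : ∀ {a} → Gb (fm a) a
  ·L   : ∀ {Γ a b c} → Gb (Γ [ fm a ,ₛ fm b ]) c → Gb (Γ [ fm (a · b) ]) c
  ·R   : ∀ {Γ₁ Γ₂ a b} → Gb Γ₁ a → Gb Γ₂ b → Gb (Γ₁ ,ₛ Γ₂) (a · b)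
  *L   : ∀ {Γ a b c} → Gb (Γ [ fm a ⨾ₛ fm b ]) c → Gb (Γ [ fm (a * b) ]) c
  *R   : ∀ {Γ₁ Γ₂ a b} → Gb Γ₁ a → Gb Γ₂ b → Gb (Γ₁ ⨾ₛ Γ₂) (a * b)
  ∖L   : ∀ {Γ Δ a b c} → Gb Δ a → Gb (Γ [ fm b ]) c → Gb (Γ [ Δ ,ₛ fm (a ∖ b) ]) c
  ∖R   : ∀ {Γ a b} → Gb (fm a ,ₛ Γ) b → Gb Γ (a ∖ b)
  ⇒L   : ∀ {Γ Δ a b c} → Gb Δ a → Gb (Γ [ fm b ]) c → Gb (Γ [ Δ ⨾ₛ fm (a ⇒ b) ]) c
  ⇒R   : ∀ {Γ a b} → Gb (fm a ⨾ₛ Γ) b → Gb Γ (a ⇒ b)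
  ∧L₁  : ∀ {Γ a b c} → Gb (Γ [ fm a ]) b → Gb (Γ [ fm (a ∧ c) ]) b
  ∧L₂  : ∀ {Γ a b c} → Gb (Γ [ fm a ]) b → Gb (Γ [ fm (c ∧ a) ]) b
  ∧R   : ∀ {Γ a b} → Gb Γ a → Gb Γ b → Gb Γ (a ∧ b)
  ∨L   : ∀ {Γ a b c} → Gb (Γ [ fm a ]) c → Gb (Γ [ fm b ]) c → Gb (Γ [ fm (a ∨ b) ]) c
  ∨R₁  : ∀ {Γ a b} → Gb Γ a → Gb Γ (a ∨ b)
  ∨R₂  : ∀ {Γ a b} → Gb Γ a → Gb Γ (b ∨ a)
  ⊥R   : ∀ {Γ Δ a} → Gb Δ ⊥ → Gb (Γ [ Δ ]) a
  Cut  : ∀ {Γ Δ a b} → Gb Δ a → Gb (Γ [ fm a ]) b → Gb (Γ [ Δ ]) b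
  R⊥   : ∀ {Δ₁ Δ₂ Δ₃} → Gb ((Δ₁ ,ₛ Δ₂) ⨾ₛ Δ₃) ⊥ → Gb ((Δ₁ ,ₛ Δ₃) ⨾ₛ Δ₂) ⊥
  Ex   : ∀ {Γ Δ₁ Δ₂ b} → Gb (Γ [ Δ₁ ,ₛ Δ₂ ]) b → Gb (Γ [ Δ₂ ,ₛ Δ₁ ]) b
  Ex⨾  : ∀ {Γ Δ₁ Δ₂ b} → Gb (Γ [ Δ₁ ⨾ₛ Δ₂ ]) b → Gb (Γ [ Δ₂ ⨾ₛ Δ₁ ]) b
  As₁  : ∀ {Γ Δ₁ Δ₂ Δ₃ b} → Gb (Γ [ Δ₁ ,ₛ (Δ₂ ,ₛ Δ₃) ]) b → Gb (Γ [ (Δ₁ ,ₛ Δ₂) ,ₛ Δ₃ ]) b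
  As₂  : ∀ {Γ Δ₁ Δ₂ Δ₃ b} → Gb (Γ [ (Δ₁ ,ₛ Δ₂) ,ₛ Δ₃ ]) b → Gb (Γ [ Δ₁ ,ₛ (Δ₂ ,ₛ Δ₃) ]) b

⊢Gb : Str → Fm → Set
⊢Gb Γ a = Gb Γ a

data _⊑_ : Fm → Fm → Set where
  ⊑-refl : ∀ {a} → a ⊑ a
  ⊑·ₗ : ∀ {c a b} → c ⊑ a → c ⊑ (a · b)
  ⊑·ᵣ : ∀ {c a b} → c ⊑ b → c ⊑ (a · b)
  ⊑∖ₗ : ∀ {c a b} → c ⊑ a → c ⊑ (a ∖ b)
  ⊑∖ᵣ : ∀ {c a b} → c ⊑ b → c ⊑ (a ∖ b)
  ⊑∧ₗ : ∀ {c a b} → c ⊑ a → c ⊑ (a ∧ b)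
  ⊑∧ᵣ : ∀ {c a b} → c ⊑ b → c ⊑ (a ∧ b)
  ⊑∨ₗ : ∀ {c a b} → c ⊑ a → c ⊑ (a ∨ b)
  ⊑∨ᵣ : ∀ {c a b} → c ⊑ b → c ⊑ (a ∨ b)
  ⊑*ₗ : ∀ {c a b} → c ⊑ a → c ⊑ (a * b)
  ⊑*ᵣ : ∀ {c a b} → c ⊑ b → c ⊑ (a * b)
  ⊑⇒ₗ : ∀ {c a b} → c ⊑ a → c ⊑ (a ⇒ b)
  ⊑⇒ᵣ : ∀ {c a b} → c ⊑ b → c ⊑ (a ⇒ b)

data _∈ₛ_ : Fm → Str → Set where
  here : ∀ {a} → a ∈ₛ fm a
  ,ₗ   : ∀ {a S T} → a ∈ₛ S → a ∈ₛ (S ,ₛ T)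
  ,ᵣ   : ∀ {a S T} → a ∈ₛ T → a ∈ₛ (S ,ₛ T)
  ⨾ₗ   : ∀ {a S T} → a ∈ₛ S → a ∈ₛ (S ⨾ₛ T)
  ⨾ᵣ   : ∀ {a S T} → a ∈ₛ T → a ∈ₛ (S ⨾ₛ T)

_∈Seq_⇒_ : Fm → Str → Fm → Set
c ∈Seq Γ ⇒ a = c ∈ₛ Γ ⊎ c ≡ a

SubSeq : Str → Fm → Fm → Set
SubSeq Γ a c = ∃[ d ] (d ∈Seq Γ ⇒ a × c ⊑ d)

data _∈D_ : ∀ {Γ a} → Fm → Gb Γ a → Set where
  root : ∀ {Γ a c} {d : Gb Γ a} → c ∈Seq Γ ⇒ a → c ∈D d
  ·L-p : ∀ {Γ a b c e} {d : Gb (Γ [ fm a ,ₛ fm b ]) c} → e ∈D d → e ∈D ·L {Γ} d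
  ·R-1 : ∀ {Γ₁ Γ₂ a b e} {d₁ : Gb Γ₁ a} {d₂ : Gb Γ₂ b} → e ∈D d₁ → e ∈D ·R d₁ d₂
  ·R-2 : ∀ {Γ₁ Γ₂ a b e} {d₁ : Gb Γ₁ a} {d₂ : Gb Γ₂ b} → e ∈D d₂ → e ∈D ·R d₁ d₂
  *L-p : ∀ {Γ a b c e} {d : Gb (Γ [ fm a ⨾ₛ fm b ]) c} → e ∈D d → e ∈D *L {Γ} d
  *R-1 : ∀ {Γ₁ Γ₂ a b e} {d₁ : Gb Γ₁ a} {d₂ : Gb Γ₂ b} → e ∈D d₁ → e ∈D *R d₁ d₂
  *R-2 : ∀ {Γ₁ Γ₂ a b e} {d₁ : Gb Γ₁ a} {d₂ : Gb Γ₂ b} → e ∈D d₂ → e ∈D *R d₁ d₂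
  ∖L-1 : ∀ {Γ Δ a b c e} {d₁ : Gb Δ a} {d₂ : Gb (Γ [ fm b ]) c} → e ∈D d₁ → e ∈D ∖L {Γ} d₁ d₂
  ∖L-2 : ∀ {Γ Δ a b c e} {d₁ : Gb Δ a} {d₂ : Gb (Γ [ fm b ]) c} → e ∈D d₂ → e ∈D ∖L {Γ} d₁ d₂
  ∖R-p : ∀ {Γ a b e} {d : Gb (fm a ,ₛ Γ) b} → e ∈D d → e ∈D ∖R d
  ⇒L-1 : ∀ {Γ Δ a b c e} {d₁ : Gb Δ a} {d₂ : Gb (Γ [ fm b ]) c} → e ∈D d₁ → e ∈D ⇒L {Γ} d₁ d₂
  ⇒L-2 : ∀ {Γ Δ a b c e} {d₁ : Gb Δ a} {d₂ : Gb (Γ [ fm b ]) c} → e ∈D d₂ → e ∈D ⇒L {Γ} d₁ d₂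
  ⇒R-p : ∀ {Γ a b e} {d : Gb (fm a ⨾ₛ Γ) b} → e ∈D d → e ∈D ⇒R d
  ∧L₁-p : ∀ {Γ a b c e} {d : Gb (Γ [ fm a ]) b} → e ∈D d → e ∈D ∧L₁ {Γ} {a} {b} {c} d
  ∧L₂-p : ∀ {Γ a b c e} {d : Gb (Γ [ fm a ]) b} → e ∈D d → e ∈D ∧L₂ {Γ} {a} {b} {c} d
  ∧R-1 : ∀ {Γ a b e} {d₁ : Gb Γ a} {d₂ : Gb Γ b} → e ∈D d₁ → e ∈D ∧R d₁ d₂
  ∧R-2 : ∀ {Γ a b e} {d₁ : Gb Γ a} {d₂ : Gb Γ b} → e ∈D d₂ → e ∈D ∧R d₁ d₂
  ∨L-1 : ∀ {Γ a b c e} {d₁ : Gb (Γ [ fm a ]) c} {d₂ : Gb (Γ [ fm b ]) c} → e ∈D d₁ → e ∈D ∨L {Γ} d₁ d₂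
  ∨L-2 : ∀ {Γ a b c e} {d₁ : Gb (Γ [ fm a ]) c} {d₂ : Gb (Γ [ fm b ]) c} → e ∈D d₂ → e ∈D ∨L {Γ} d₁ d₂
  ∨R₁-p : ∀ {Γ a b e} {d : Gb Γ a} → e ∈D d → e ∈D ∨R₁ {Γ} {a} {b} d
  ∨R₂-p : ∀ {Γ a b e} {d : Gb Γ a} → e ∈D d → e ∈D ∨R₂ {Γ} {a} {b} d
  ⊥R-p : ∀ {Γ Δ a e} {d : Gb Δ ⊥} → e ∈D d → e ∈D ⊥R {Γ} {Δ} {a} d
  Cut-1 : ∀ {Γ Δ a b e} {d₁ : Gb Δ a} {d₂ : Gb (Γ [ fm a ]) b} → e ∈D d₁ → e ∈D Cut {Γ} d₁ d₂
  Cut-2 : ∀ {Γ Δ a b e} {d₁ : Gb Δ a} {d₂ : Gb (Γ [ fm a ]) b} → e ∈D d₂ → e ∈D Cut {Γ} d₁ d₂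
  R⊥-p : ∀ {Δ₁ Δ₂ Δ₃ e} {d : Gb ((Δ₁ ,ₛ Δ₂) ⨾ₛ Δ₃) ⊥} → e ∈D d → e ∈D R⊥ d
  Ex-p : ∀ {Γ Δ₁ Δ₂ b e} {d : Gb (Γ [ Δ₁ ,ₛ Δ₂ ]) b} → e ∈D d → e ∈D Ex {Γ} {Δ₁} {Δ₂} d
  Ex⨾-p : ∀ {Γ Δ₁ Δ₂ b e} {d : Gb (Γ [ Δ₁ ⨾ₛ Δ₂ ]) b} → e ∈D d → e ∈D Ex⨾ {Γ} {Δ₁} {Δ₂} d
  As₁-p : ∀ {Γ Δ₁ Δ₂ Δ₃ b e} {d : Gb (Γ [ Δ₁ ,ₛ (Δ₂ ,ₛ Δ₃) ]) b} → e ∈D d → e ∈D As₁ {Γ} {Δ₁} {Δ₂} {Δ₃} d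
  As₂-p : ∀ {Γ Δ₁ Δ₂ Δ₃ b e} {d : Gb (Γ [ (Δ₁ ,ₛ Δ₂) ,ₛ Δ₃ ]) b} → e ∈D d → e ∈D As₂ {Γ} {Δ₁} {Δ₂} {Δ₃} d

-- Cut elimination is proved semantically. Sets of structures closed under
-- the Galois closure induced by cut-free provability form a model of Gb in
-- which every formula a is interpreted by a set ⟦ a ⟧ that contains the
-- structure fm a and consists of structures Γ with Γ ⇒ a cut-free derivable.
-- Soundness of Gb for this model then turns any derivation of Γ ⇒ a into a
-- cut-free one. Every rule other than (Cut) only uses subformulas of its
-- conclusion, except (⊥), which forgets the premise's succedent ⊥; but in a
-- cut-free derivation of Δ ⇒ ⊥ the formula ⊥ already occurs inside Δ.
{-# OPTIONS --safe #-}
module Submission where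

open import Defs
open import Data.Product using (Σ; ∃-syntax; _×_; _,_; proj₁; proj₂)
open import Data.Sum using (_⊎_; inj₁; inj₂)
open import Level using (0ℓ)
open import Relation.Binary.PropositionalEquality using (_≡_; refl; sym; subst)
open import Relation.Unary using (Pred; _⊆_; _∪_; _∩_; ｛_｝)

data CutFree : Str → Fm → Set where
  Id   : ∀ {a} → CutFree (fm a) a
  ·L   : ∀ {Γ a b c} → CutFree (Γ [ fm a ,ₛ fm b ]) c → CutFree (Γ [ fm (a · b) ]) c
  ·R   : ∀ {Γ₁ Γ₂ a b} → CutFree Γ₁ a → CutFree Γ₂ b → CutFree (Γ₁ ,ₛ Γ₂) (a · b)
  *L   : ∀ {Γ a b c} → CutFree (Γ [ fm a ⨾ₛ fm b ]) c → CutFree (Γ [ fm (a * b) ]) c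
  *R   : ∀ {Γ₁ Γ₂ a b} → CutFree Γ₁ a → CutFree Γ₂ b → CutFree (Γ₁ ⨾ₛ Γ₂) (a * b)
  ∖L   : ∀ {Γ Δ a b c} → CutFree Δ a → CutFree (Γ [ fm b ]) c → CutFree (Γ [ Δ ,ₛ fm (a ∖ b) ]) c
  ∖R   : ∀ {Γ a b} → CutFree (fm a ,ₛ Γ) b → CutFree Γ (a ∖ b)
  ⇒L   : ∀ {Γ Δ a b c} → CutFree Δ a → CutFree (Γ [ fm b ]) c → CutFree (Γ [ Δ ⨾ₛ fm (a ⇒ b) ]) c
  ⇒R   : ∀ {Γ a b} → CutFree (fm a ⨾ₛ Γ) b → CutFree Γ (a ⇒ b)
  ∧L₁  : ∀ {Γ a b c} → CutFree (Γ [ fm a ]) b → CutFree (Γ [ fm (a ∧ c) ]) b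
  ∧L₂  : ∀ {Γ a b c} → CutFree (Γ [ fm a ]) b → CutFree (Γ [ fm (c ∧ a) ]) b
  ∧R   : ∀ {Γ a b} → CutFree Γ a → CutFree Γ b → CutFree Γ (a ∧ b)
  ∨L   : ∀ {Γ a b c} → CutFree (Γ [ fm a ]) c → CutFree (Γ [ fm b ]) c → CutFree (Γ [ fm (a ∨ b) ]) c
  ∨R₁  : ∀ {Γ a b} → CutFree Γ a → CutFree Γ (a ∨ b)
  ∨R₂  : ∀ {Γ a b} → CutFree Γ a → CutFree Γ (b ∨ a)
  ⊥R   : ∀ {Γ Δ a} → CutFree Δ ⊥ → CutFree (Γ [ Δ ]) a
  R⊥   : ∀ {Δ₁ Δ₂ Δ₃} → CutFree ((Δ₁ ,ₛ Δ₂) ⨾ₛ Δ₃) ⊥ → CutFree ((Δ₁ ,ₛ Δ₃) ⨾ₛ Δ₂) ⊥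
  Ex   : ∀ {Γ Δ₁ Δ₂ b} → CutFree (Γ [ Δ₁ ,ₛ Δ₂ ]) b → CutFree (Γ [ Δ₂ ,ₛ Δ₁ ]) b
  Ex⨾  : ∀ {Γ Δ₁ Δ₂ b} → CutFree (Γ [ Δ₁ ⨾ₛ Δ₂ ]) b → CutFree (Γ [ Δ₂ ⨾ₛ Δ₁ ]) b
  As₁  : ∀ {Γ Δ₁ Δ₂ Δ₃ b} → CutFree (Γ [ Δ₁ ,ₛ (Δ₂ ,ₛ Δ₃) ]) b → CutFree (Γ [ (Δ₁ ,ₛ Δ₂) ,ₛ Δ₃ ]) b
  As₂  : ∀ {Γ Δ₁ Δ₂ Δ₃ b} → CutFree (Γ [ (Δ₁ ,ₛ Δ₂) ,ₛ Δ₃ ]) b → CutFree (Γ [ Δ₁ ,ₛ (Δ₂ ,ₛ Δ₃) ]) b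

embed : ∀ {Γ a} → CutFree Γ a → Gb Γ a
embed Id = Id
embed (·L {C} d) = ·L {C} (embed d)
embed (·R d e) = ·R (embed d) (embed e)
embed (*L {C} d) = *L {C} (embed d)
embed (*R d e) = *R (embed d) (embed e)
embed (∖L {C} d e) = ∖L {C} (embed d) (embed e)
embed (∖R d) = ∖R (embed d)
embed (⇒L {C} d e) = ⇒L {C} (embed d) (embed e)
embed (⇒R d) = ⇒R (embed d)
embed (∧L₁ {C} {a} {b} {c} d) = ∧L₁ {C} {a} {b} {c} (embed d)
embed (∧L₂ {C} {a} {b} {c} d) = ∧L₂ {C} {a} {b} {c} (embed d)
embed (∧R d e) = ∧R (embed d) (embed e)
embed (∨L {C} d e) = ∨L {C} (embed d) (embed e)
embed (∨R₁ {Γ} {a} {b} d) = ∨R₁ {Γ} {a} {b} (embed d)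
embed (∨R₂ {Γ} {a} {b} d) = ∨R₂ {Γ} {a} {b} (embed d)
embed (⊥R {C} {Δ} {a} d) = ⊥R {C} {Δ} {a} (embed d)
embed (R⊥ d) = R⊥ (embed d)
embed (Ex {C} {Δ₁} {Δ₂} d) = Ex {C} {Δ₁} {Δ₂} (embed d)
embed (Ex⨾ {C} {Δ₁} {Δ₂} d) = Ex⨾ {C} {Δ₁} {Δ₂} (embed d)
embed (As₁ {C} {Δ₁} {Δ₂} {Δ₃} d) = As₁ {C} {Δ₁} {Δ₂} {Δ₃} (embed d)
embed (As₂ {C} {Δ₁} {Δ₂} {Δ₃} d) = As₂ {C} {Δ₁} {Δ₂} {Δ₃} (embed d)

_∘ᶜ_ : Ctx → Ctx → Ctx
∙ ∘ᶜ D = D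
_,ₗ_ E S ∘ᶜ D = _,ₗ_ (E ∘ᶜ D) S
_,ᵣ_ S E ∘ᶜ D = _,ᵣ_ S (E ∘ᶜ D)
_⨾ₗ_ E S ∘ᶜ D = _⨾ₗ_ (E ∘ᶜ D) S
_⨾ᵣ_ S E ∘ᶜ D = _⨾ᵣ_ S (E ∘ᶜ D)

∘ᶜ-[] : ∀ E D Y → (E ∘ᶜ D) [ Y ] ≡ E [ D [ Y ] ]
∘ᶜ-[] ∙ D Y = refl
∘ᶜ-[] (_,ₗ_ E S) D Y rewrite ∘ᶜ-[] E D Y = refl
∘ᶜ-[] (_,ᵣ_ S E) D Y rewrite ∘ᶜ-[] E D Y = refl
∘ᶜ-[] (_⨾ₗ_ E S) D Y rewrite ∘ᶜ-[] E D Y = refl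
∘ᶜ-[] (_⨾ᵣ_ S E) D Y rewrite ∘ᶜ-[] E D Y = refl

StrPred : Set₁
StrPred = Pred Str 0ℓ

-- The Galois closure of the residuated frame relating a structure Γ to a
-- context-with-succedent (C , c) when C [ Γ ] ⇒ c is cut-free derivable.
Cl : StrPred → StrPred
Cl X Γ = ∀ C c → (∀ Δ → X Δ → CutFree (C [ Δ ]) c) → CutFree (C [ Γ ]) c

Closed : StrPred → Set
Closed X = Cl X ⊆ X

Cl-extensive : ∀ {X} → X ⊆ Cl X
Cl-extensive x C c f = f _ x

Cl-mono : ∀ {X Y} → X ⊆ Y → Cl X ⊆ Cl Y
Cl-mono X⊆Y h C c f = h C c (λ Δ x → f Δ (X⊆Y x))

Cl-closed : ∀ {X} → Closed (Cl X)
Cl-closed h C c f = h C c (λ Δ y → y C c f)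

Cl-elim : ∀ {P Q : StrPred} D {Y} → Closed P →
          (∀ {Z} → Q Z → P (D [ Z ])) → Cl Q Y → P (D [ Y ])
Cl-elim D {Y} P-closed f q = P-closed λ E e g →
  subst (λ W → CutFree W e) (∘ᶜ-[] E D Y)
    (q (E ∘ᶜ D) e (λ Z z → subst (λ W → CutFree W e) (sym (∘ᶜ-[] E D Z)) (g _ (f z))))

Closed-rule : ∀ {P} D Z Z' → Closed P →
              (∀ E {c} → CutFree (E [ Z ]) c → CutFree (E [ Z' ]) c) →
              P (D [ Z ]) → P (D [ Z' ])
Closed-rule {P} D Z Z' P-closed rule p =
  Cl-elim {P} {｛ Z ｝} D P-closed (λ { refl → p }) (λ C c f → rule C (f Z refl))

data _⊗_ (X Y : StrPred) : StrPred where
  _,,_ : ∀ {Γ Δ} → X Γ → Y Δ → (X ⊗ Y) (Γ ,ₛ Δ)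

data _⊙_ (X Y : StrPred) : StrPred where
  _&&_ : ∀ {Γ Δ} → X Γ → Y Δ → (X ⊙ Y) (Γ ⨾ₛ Δ)

⟦_⟧ : Fm → StrPred
⟦ var n ⟧ Γ = CutFree Γ (var n)
⟦ ⊥ ⟧ Γ = CutFree Γ ⊥
⟦ a · b ⟧ = Cl (⟦ a ⟧ ⊗ ⟦ b ⟧)
⟦ a * b ⟧ = Cl (⟦ a ⟧ ⊙ ⟦ b ⟧)
⟦ a ∖ b ⟧ Γ = ∀ Δ → ⟦ a ⟧ Δ → ⟦ b ⟧ (Δ ,ₛ Γ)
⟦ a ⇒ b ⟧ Γ = ∀ Δ → ⟦ a ⟧ Δ → ⟦ b ⟧ (Δ ⨾ₛ Γ)
⟦ a ∧ b ⟧ = ⟦ a ⟧ ∩ ⟦ b ⟧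
⟦ a ∨ b ⟧ = Cl (⟦ a ⟧ ∪ ⟦ b ⟧)

⟦⟧-closed : ∀ a → Closed ⟦ a ⟧
⟦⟧-closed (var n) h = h ∙ (var n) (λ Δ x → x)
⟦⟧-closed ⊥ h = h ∙ ⊥ (λ Δ x → x)
⟦⟧-closed (a · b) = Cl-closed
⟦⟧-closed (a * b) = Cl-closed
⟦⟧-closed (a ∖ b) h Δ p = Cl-elim (_,ᵣ_ Δ ∙) (⟦⟧-closed b) (λ f → f Δ p) h
⟦⟧-closed (a ⇒ b) h Δ p = Cl-elim (_⨾ᵣ_ Δ ∙) (⟦⟧-closed b) (λ f → f Δ p) h
⟦⟧-closed (a ∧ b) h = ⟦⟧-closed a (Cl-mono proj₁ h) , ⟦⟧-closed b (Cl-mono proj₂ h)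
⟦⟧-closed (a ∨ b) = Cl-closed

⟦⟧⊆CutFree : ∀ a {Γ} → ⟦ a ⟧ Γ → CutFree Γ a
fm∈⟦⟧ : ∀ a → ⟦ a ⟧ (fm a)

⟦⟧⊆CutFree (var n) x = x
⟦⟧⊆CutFree ⊥ x = x
⟦⟧⊆CutFree (a · b) x = x ∙ (a · b) λ { _ (p ,, q) → ·R (⟦⟧⊆CutFree a p) (⟦⟧⊆CutFree b q) }
⟦⟧⊆CutFree (a * b) x = x ∙ (a * b) λ { _ (p && q) → *R (⟦⟧⊆CutFree a p) (⟦⟧⊆CutFree b q) }
⟦⟧⊆CutFree (a ∖ b) x = ∖R (⟦⟧⊆CutFree b (x (fm a) (fm∈⟦⟧ a)))
⟦⟧⊆CutFree (a ⇒ b) x = ⇒R (⟦⟧⊆CutFree b (x (fm a) (fm∈⟦⟧ a)))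
⟦⟧⊆CutFree (a ∧ b) (p , q) = ∧R (⟦⟧⊆CutFree a p) (⟦⟧⊆CutFree b q)
⟦⟧⊆CutFree (a ∨ b) x = x ∙ (a ∨ b) λ { _ (inj₁ p) → ∨R₁ (⟦⟧⊆CutFree a p)
                                     ; _ (inj₂ q) → ∨R₂ (⟦⟧⊆CutFree b q) }

fm∈⟦⟧ (var n) = Id
fm∈⟦⟧ ⊥ = Id
fm∈⟦⟧ (a · b) C c f = ·L {C} (f _ (fm∈⟦⟧ a ,, fm∈⟦⟧ b))
fm∈⟦⟧ (a * b) C c f = *L {C} (f _ (fm∈⟦⟧ a && fm∈⟦⟧ b))
fm∈⟦⟧ (a ∖ b) Δ p = ⟦⟧-closed b λ C c f → ∖L {C} (⟦⟧⊆CutFree a p) (f (fm b) (fm∈⟦⟧ b))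
fm∈⟦⟧ (a ⇒ b) Δ p = ⟦⟧-closed b λ C c f → ⇒L {C} (⟦⟧⊆CutFree a p) (f (fm b) (fm∈⟦⟧ b))
fm∈⟦⟧ (a ∧ b) = ⟦⟧-closed a (λ C c f → ∧L₁ {C} (f _ (fm∈⟦⟧ a)))
              , ⟦⟧-closed b (λ C c f → ∧L₂ {C} (f _ (fm∈⟦⟧ b)))
fm∈⟦⟧ (a ∨ b) C c f = ∨L {C} (f _ (inj₁ (fm∈⟦⟧ a))) (f _ (inj₂ (fm∈⟦⟧ b)))

⟦_⟧ₛ : Str → StrPred
⟦ fm a ⟧ₛ = ⟦ a ⟧
⟦ Γ ,ₛ Δ ⟧ₛ = ⟦ Γ ⟧ₛ ⊗ ⟦ Δ ⟧ₛ
⟦ Γ ⨾ₛ Δ ⟧ₛ = ⟦ Γ ⟧ₛ ⊙ ⟦ Δ ⟧ₛ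

⟦⟧ₛ-refl : ∀ Γ → ⟦ Γ ⟧ₛ Γ
⟦⟧ₛ-refl (fm a) = fm∈⟦⟧ a
⟦⟧ₛ-refl (Γ ,ₛ Δ) = ⟦⟧ₛ-refl Γ ,, ⟦⟧ₛ-refl Δ
⟦⟧ₛ-refl (Γ ⨾ₛ Δ) = ⟦⟧ₛ-refl Γ && ⟦⟧ₛ-refl Δ

data ⟦_⟧ᶜ : Ctx → Ctx → Set where
  ∙    : ⟦ ∙ ⟧ᶜ ∙
  _◂,_ : ∀ {C D S T} → ⟦ C ⟧ᶜ D → ⟦ S ⟧ₛ T → ⟦ _,ₗ_ C S ⟧ᶜ (_,ₗ_ D T)
  _,▸_ : ∀ {C D S T} → ⟦ S ⟧ₛ T → ⟦ C ⟧ᶜ D → ⟦ _,ᵣ_ S C ⟧ᶜ (_,ᵣ_ T D)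
  _◂⨾_ : ∀ {C D S T} → ⟦ C ⟧ᶜ D → ⟦ S ⟧ₛ T → ⟦ _⨾ₗ_ C S ⟧ᶜ (_⨾ₗ_ D T)
  _⨾▸_ : ∀ {C D S T} → ⟦ S ⟧ₛ T → ⟦ C ⟧ᶜ D → ⟦ _⨾ᵣ_ S C ⟧ᶜ (_⨾ᵣ_ T D)

⟦⟧ᶜ-[] : ∀ {C D Δ Y} → ⟦ C ⟧ᶜ D → ⟦ Δ ⟧ₛ Y → ⟦ C [ Δ ] ⟧ₛ (D [ Y ])
⟦⟧ᶜ-[] ∙ y = y
⟦⟧ᶜ-[] (c ◂, s) y = ⟦⟧ᶜ-[] c y ,, s
⟦⟧ᶜ-[] (s ,▸ c) y = s ,, ⟦⟧ᶜ-[] c y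
⟦⟧ᶜ-[] (c ◂⨾ s) y = ⟦⟧ᶜ-[] c y && s
⟦⟧ᶜ-[] (s ⨾▸ c) y = s && ⟦⟧ᶜ-[] c y

data Split (C : Ctx) (Δ : Str) : Str → Set where
  split : ∀ {D Y} → ⟦ C ⟧ᶜ D → ⟦ Δ ⟧ₛ Y → Split C Δ (D [ Y ])

⟦⟧ₛ-split : ∀ C {Δ X} → ⟦ C [ Δ ] ⟧ₛ X → Split C Δ X
⟦⟧ₛ-split ∙ x = split ∙ x
⟦⟧ₛ-split (_,ₗ_ C S) (x ,, s) with ⟦⟧ₛ-split C x
... | split c y = split (c ◂, s) y
⟦⟧ₛ-split (_,ᵣ_ S C) (s ,, x) with ⟦⟧ₛ-split C x
... | split c y = split (s ,▸ c) y
⟦⟧ₛ-split (_⨾ₗ_ C S) (x && s) with ⟦⟧ₛ-split C x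
... | split c y = split (c ◂⨾ s) y
⟦⟧ₛ-split (_⨾ᵣ_ S C) (s && x) with ⟦⟧ₛ-split C x
... | split c y = split (s ⨾▸ c) y

soundness : ∀ {Γ a} → Gb Γ a → ⟦ Γ ⟧ₛ ⊆ ⟦ a ⟧
soundness Id x = x
soundness (·L {C} {c = c} d) x with ⟦⟧ₛ-split C x
... | split {D} ĉ y = Cl-elim D (⟦⟧-closed c) (λ { (p ,, q) → soundness d (⟦⟧ᶜ-[] ĉ (p ,, q)) }) y
soundness (·R d e) (x ,, y) = Cl-extensive (soundness d x ,, soundness e y)
soundness (*L {C} {c = c} d) x with ⟦⟧ₛ-split C x
... | split {D} ĉ y = Cl-elim D (⟦⟧-closed c) (λ { (p && q) → soundness d (⟦⟧ᶜ-[] ĉ (p && q)) }) y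
soundness (*R d e) (x && y) = Cl-extensive (soundness d x && soundness e y)
soundness (∖L {C} d e) x with ⟦⟧ₛ-split C x
... | split ĉ (y ,, f) = soundness e (⟦⟧ᶜ-[] ĉ (f _ (soundness d y)))
soundness (∖R d) x Δ p = soundness d (p ,, x)
soundness (⇒L {C} d e) x with ⟦⟧ₛ-split C x
... | split ĉ (y && f) = soundness e (⟦⟧ᶜ-[] ĉ (f _ (soundness d y)))
soundness (⇒R d) x Δ p = soundness d (p && x)
soundness (∧L₁ {C} d) x with ⟦⟧ₛ-split C x
... | split ĉ y = soundness d (⟦⟧ᶜ-[] ĉ (proj₁ y))
soundness (∧L₂ {C} d) x with ⟦⟧ₛ-split C x
... | split ĉ y = soundness d (⟦⟧ᶜ-[] ĉ (proj₂ y))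
soundness (∧R d e) x = soundness d x , soundness e x
soundness (∨L {C} {c = c} d e) x with ⟦⟧ₛ-split C x
... | split {D} ĉ y = Cl-elim D (⟦⟧-closed c)
      (λ { (inj₁ p) → soundness d (⟦⟧ᶜ-[] ĉ p) ; (inj₂ q) → soundness e (⟦⟧ᶜ-[] ĉ q) }) y
soundness (∨R₁ d) x = Cl-extensive (inj₁ (soundness d x))
soundness (∨R₂ d) x = Cl-extensive (inj₂ (soundness d x))
soundness (⊥R {C} {a = a} d) x with ⟦⟧ₛ-split C x
... | split {D} {Y} _ y = ⟦⟧-closed a λ E e _ →
      subst (λ W → CutFree W e) (∘ᶜ-[] E D Y) (⊥R {E ∘ᶜ D} (soundness d y))
soundness (Cut {C} d e) x with ⟦⟧ₛ-split C x
... | split ĉ y = soundness e (⟦⟧ᶜ-[] ĉ (soundness d y))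
soundness (R⊥ d) ((x₁ ,, x₃) && x₂) = R⊥ (soundness d ((x₁ ,, x₂) && x₃))
soundness (Ex {C} {b = b} d) x with ⟦⟧ₛ-split C x
... | split {D} ĉ (_,,_ {Y₂} {Y₁} y₂ y₁) =
  Closed-rule D (Y₁ ,ₛ Y₂) (Y₂ ,ₛ Y₁) (⟦⟧-closed b) (λ E → Ex {E})
    (soundness d (⟦⟧ᶜ-[] ĉ (y₁ ,, y₂)))
soundness (Ex⨾ {C} {b = b} d) x with ⟦⟧ₛ-split C x
... | split {D} ĉ (_&&_ {Y₂} {Y₁} y₂ y₁) =
  Closed-rule D (Y₁ ⨾ₛ Y₂) (Y₂ ⨾ₛ Y₁) (⟦⟧-closed b) (λ E → Ex⨾ {E})
    (soundness d (⟦⟧ᶜ-[] ĉ (y₁ && y₂)))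
soundness (As₁ {C} {b = b} d) x with ⟦⟧ₛ-split C x
... | split {D} ĉ (_,,_ {_} {Y₃} (_,,_ {Y₁} {Y₂} y₁ y₂) y₃) =
  Closed-rule D (Y₁ ,ₛ (Y₂ ,ₛ Y₃)) ((Y₁ ,ₛ Y₂) ,ₛ Y₃) (⟦⟧-closed b) (λ E → As₁ {E})
    (soundness d (⟦⟧ᶜ-[] ĉ (y₁ ,, (y₂ ,, y₃))))
soundness (As₂ {C} {b = b} d) x with ⟦⟧ₛ-split C x
... | split {D} ĉ (_,,_ {Y₁} y₁ (_,,_ {Y₂} {Y₃} y₂ y₃)) =
  Closed-rule D ((Y₁ ,ₛ Y₂) ,ₛ Y₃) (Y₁ ,ₛ (Y₂ ,ₛ Y₃)) (⟦⟧-closed b) (λ E → As₂ {E})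
    (soundness d (⟦⟧ᶜ-[] ĉ ((y₁ ,, y₂) ,, y₃)))

cut-elimination : ∀ {Γ a} → Gb Γ a → CutFree Γ a
cut-elimination {Γ} {a} d = ⟦⟧⊆CutFree a (soundness d (⟦⟧ₛ-refl Γ))

⊑-trans : ∀ {a b c} → a ⊑ b → b ⊑ c → a ⊑ c
⊑-trans p ⊑-refl = p
⊑-trans p (⊑·ₗ q) = ⊑·ₗ (⊑-trans p q)
⊑-trans p (⊑·ᵣ q) = ⊑·ᵣ (⊑-trans p q)
⊑-trans p (⊑∖ₗ q) = ⊑∖ₗ (⊑-trans p q)
⊑-trans p (⊑∖ᵣ q) = ⊑∖ᵣ (⊑-trans p q)
⊑-trans p (⊑∧ₗ q) = ⊑∧ₗ (⊑-trans p q)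
⊑-trans p (⊑∧ᵣ q) = ⊑∧ᵣ (⊑-trans p q)
⊑-trans p (⊑∨ₗ q) = ⊑∨ₗ (⊑-trans p q)
⊑-trans p (⊑∨ᵣ q) = ⊑∨ᵣ (⊑-trans p q)
⊑-trans p (⊑*ₗ q) = ⊑*ₗ (⊑-trans p q)
⊑-trans p (⊑*ᵣ q) = ⊑*ᵣ (⊑-trans p q)
⊑-trans p (⊑⇒ₗ q) = ⊑⇒ₗ (⊑-trans p q)
⊑-trans p (⊑⇒ᵣ q) = ⊑⇒ᵣ (⊑-trans p q)

infix 4 _⊑ₛ_ _≼_

_⊑ₛ_ : Fm → Str → Set
c ⊑ₛ Γ = ∃[ d ] (d ∈ₛ Γ × c ⊑ d)

_≼_ : Str → Str → Set
Δ ≼ Γ = ∀ {c} → c ∈ₛ Δ → c ⊑ₛ Γ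

∈ₛ⇒⊑ₛ : ∀ {c Γ} → c ∈ₛ Γ → c ⊑ₛ Γ
∈ₛ⇒⊑ₛ c∈Γ = _ , c∈Γ , ⊑-refl

⊑ₛ-≼ : ∀ {c Δ Γ} → c ⊑ₛ Δ → Δ ≼ Γ → c ⊑ₛ Γ
⊑ₛ-≼ (d , d∈Δ , c⊑d) Δ≼Γ with Δ≼Γ d∈Δ
... | e , e∈Γ , d⊑e = e , e∈Γ , ⊑-trans c⊑d d⊑e

∈ₛ-[] : ∀ C {Δ c} → c ∈ₛ Δ → c ∈ₛ (C [ Δ ])
∈ₛ-[] ∙ m = m
∈ₛ-[] (_,ₗ_ C S) m = ,ₗ (∈ₛ-[] C m)
∈ₛ-[] (_,ᵣ_ S C) m = ,ᵣ (∈ₛ-[] C m)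
∈ₛ-[] (_⨾ₗ_ C S) m = ⨾ₗ (∈ₛ-[] C m)
∈ₛ-[] (_⨾ᵣ_ S C) m = ⨾ᵣ (∈ₛ-[] C m)

∈ₛ-[]⁻ : ∀ C {Δ c} → c ∈ₛ (C [ Δ ]) → (∀ Δ' → c ∈ₛ (C [ Δ' ])) ⊎ c ∈ₛ Δ
∈ₛ-[]⁻ ∙ m = inj₂ m
∈ₛ-[]⁻ (_,ₗ_ C S) (,ₗ m) with ∈ₛ-[]⁻ C m
... | inj₁ f = inj₁ (λ Δ' → ,ₗ (f Δ'))
... | inj₂ q = inj₂ q
∈ₛ-[]⁻ (_,ₗ_ C S) (,ᵣ m) = inj₁ (λ _ → ,ᵣ m)
∈ₛ-[]⁻ (_,ᵣ_ S C) (,ᵣ m) with ∈ₛ-[]⁻ C m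
... | inj₁ f = inj₁ (λ Δ' → ,ᵣ (f Δ'))
... | inj₂ q = inj₂ q
∈ₛ-[]⁻ (_,ᵣ_ S C) (,ₗ m) = inj₁ (λ _ → ,ₗ m)
∈ₛ-[]⁻ (_⨾ₗ_ C S) (⨾ₗ m) with ∈ₛ-[]⁻ C m
... | inj₁ f = inj₁ (λ Δ' → ⨾ₗ (f Δ'))
... | inj₂ q = inj₂ q
∈ₛ-[]⁻ (_⨾ₗ_ C S) (⨾ᵣ m) = inj₁ (λ _ → ⨾ᵣ m)
∈ₛ-[]⁻ (_⨾ᵣ_ S C) (⨾ᵣ m) with ∈ₛ-[]⁻ C m
... | inj₁ f = inj₁ (λ Δ' → ⨾ᵣ (f Δ'))
... | inj₂ q = inj₂ q
∈ₛ-[]⁻ (_⨾ᵣ_ S C) (⨾ₗ m) = inj₁ (λ _ → ⨾ₗ m)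

⊑ₛ-[] : ∀ C {Δ c d} → d ∈ₛ Δ → c ⊑ d → c ⊑ₛ C [ Δ ]
⊑ₛ-[] C d∈Δ c⊑d = _ , ∈ₛ-[] C d∈Δ , c⊑d

≼-in-[] : ∀ C {Δ} → Δ ≼ C [ Δ ]
≼-in-[] C m = ∈ₛ⇒⊑ₛ (∈ₛ-[] C m)

≼-[] : ∀ C {Δ' Δ} → Δ' ≼ C [ Δ ] → C [ Δ' ] ≼ C [ Δ ]
≼-[] C {Δ'} {Δ} Δ'≼ m with ∈ₛ-[]⁻ C {Δ'} m
... | inj₁ f = ∈ₛ⇒⊑ₛ (f Δ)
... | inj₂ q = Δ'≼ q

·L-≼ : ∀ C {a b} → C [ fm a ,ₛ fm b ] ≼ C [ fm (a · b) ]
·L-≼ C = ≼-[] C λ { (,ₗ here) → ⊑ₛ-[] C here (⊑·ₗ ⊑-refl)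
                  ; (,ᵣ here) → ⊑ₛ-[] C here (⊑·ᵣ ⊑-refl) }

*L-≼ : ∀ C {a b} → C [ fm a ⨾ₛ fm b ] ≼ C [ fm (a * b) ]
*L-≼ C = ≼-[] C λ { (⨾ₗ here) → ⊑ₛ-[] C here (⊑*ₗ ⊑-refl)
                  ; (⨾ᵣ here) → ⊑ₛ-[] C here (⊑*ᵣ ⊑-refl) }

∖L-≼ : ∀ C {Δ a b} → C [ fm b ] ≼ C [ Δ ,ₛ fm (a ∖ b) ]
∖L-≼ C = ≼-[] C λ { here → ⊑ₛ-[] C (,ᵣ here) (⊑∖ᵣ ⊑-refl) }

⇒L-≼ : ∀ C {Δ a b} → C [ fm b ] ≼ C [ Δ ⨾ₛ fm (a ⇒ b) ]
⇒L-≼ C = ≼-[] C λ { here → ⊑ₛ-[] C (⨾ᵣ here) (⊑⇒ᵣ ⊑-refl) }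

∧L₁-≼ : ∀ C {a c} → C [ fm a ] ≼ C [ fm (a ∧ c) ]
∧L₁-≼ C = ≼-[] C λ { here → ⊑ₛ-[] C here (⊑∧ₗ ⊑-refl) }

∧L₂-≼ : ∀ C {a c} → C [ fm a ] ≼ C [ fm (c ∧ a) ]
∧L₂-≼ C = ≼-[] C λ { here → ⊑ₛ-[] C here (⊑∧ᵣ ⊑-refl) }

∨L₁-≼ : ∀ C {a b} → C [ fm a ] ≼ C [ fm (a ∨ b) ]
∨L₁-≼ C = ≼-[] C λ { here → ⊑ₛ-[] C here (⊑∨ₗ ⊑-refl) }

∨L₂-≼ : ∀ C {a b} → C [ fm b ] ≼ C [ fm (a ∨ b) ]
∨L₂-≼ C = ≼-[] C λ { here → ⊑ₛ-[] C here (⊑∨ᵣ ⊑-refl) }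

R⊥-≼ : ∀ {Δ₁ Δ₂ Δ₃} → (Δ₁ ,ₛ Δ₂) ⨾ₛ Δ₃ ≼ (Δ₁ ,ₛ Δ₃) ⨾ₛ Δ₂
R⊥-≼ (⨾ₗ (,ₗ m)) = ∈ₛ⇒⊑ₛ (⨾ₗ (,ₗ m))
R⊥-≼ (⨾ₗ (,ᵣ m)) = ∈ₛ⇒⊑ₛ (⨾ᵣ m)
R⊥-≼ (⨾ᵣ m) = ∈ₛ⇒⊑ₛ (⨾ₗ (,ᵣ m))

Ex-≼ : ∀ C {Δ₁ Δ₂} → C [ Δ₁ ,ₛ Δ₂ ] ≼ C [ Δ₂ ,ₛ Δ₁ ]
Ex-≼ C = ≼-[] C λ { (,ₗ m) → ⊑ₛ-[] C (,ᵣ m) ⊑-refl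
                  ; (,ᵣ m) → ⊑ₛ-[] C (,ₗ m) ⊑-refl }

Ex⨾-≼ : ∀ C {Δ₁ Δ₂} → C [ Δ₁ ⨾ₛ Δ₂ ] ≼ C [ Δ₂ ⨾ₛ Δ₁ ]
Ex⨾-≼ C = ≼-[] C λ { (⨾ₗ m) → ⊑ₛ-[] C (⨾ᵣ m) ⊑-refl
                   ; (⨾ᵣ m) → ⊑ₛ-[] C (⨾ₗ m) ⊑-refl }

As₁-≼ : ∀ C {Δ₁ Δ₂ Δ₃} → C [ Δ₁ ,ₛ (Δ₂ ,ₛ Δ₃) ] ≼ C [ (Δ₁ ,ₛ Δ₂) ,ₛ Δ₃ ]
As₁-≼ C = ≼-[] C λ { (,ₗ m) → ⊑ₛ-[] C (,ₗ (,ₗ m)) ⊑-refl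
                   ; (,ᵣ (,ₗ m)) → ⊑ₛ-[] C (,ₗ (,ᵣ m)) ⊑-refl
                   ; (,ᵣ (,ᵣ m)) → ⊑ₛ-[] C (,ᵣ m) ⊑-refl }

As₂-≼ : ∀ C {Δ₁ Δ₂ Δ₃} → C [ (Δ₁ ,ₛ Δ₂) ,ₛ Δ₃ ] ≼ C [ Δ₁ ,ₛ (Δ₂ ,ₛ Δ₃) ]
As₂-≼ C = ≼-[] C λ { (,ₗ (,ₗ m)) → ⊑ₛ-[] C (,ₗ m) ⊑-refl
                   ; (,ₗ (,ᵣ m)) → ⊑ₛ-[] C (,ᵣ (,ₗ m)) ⊑-refl
                   ; (,ᵣ m) → ⊑ₛ-[] C (,ᵣ (,ᵣ m)) ⊑-refl }

CutFree-⊥⊑ₛ : ∀ {Δ} → CutFree Δ ⊥ → ⊥ ⊑ₛ Δ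
CutFree-⊥⊑ₛ d = go d refl
  where
  go : ∀ {Δ c} → CutFree Δ c → c ≡ ⊥ → ⊥ ⊑ₛ Δ
  go Id refl = ∈ₛ⇒⊑ₛ here
  go (·L {C} d) eq = ⊑ₛ-≼ (go d eq) (·L-≼ C)
  go (*L {C} d) eq = ⊑ₛ-≼ (go d eq) (*L-≼ C)
  go (∖L {C} _ e) eq = ⊑ₛ-≼ (go e eq) (∖L-≼ C)
  go (⇒L {C} _ e) eq = ⊑ₛ-≼ (go e eq) (⇒L-≼ C)
  go (∧L₁ {C} d) eq = ⊑ₛ-≼ (go d eq) (∧L₁-≼ C)
  go (∧L₂ {C} d) eq = ⊑ₛ-≼ (go d eq) (∧L₂-≼ C)
  go (∨L {C} d _) eq = ⊑ₛ-≼ (go d eq) (∨L₁-≼ C)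
  go (⊥R {C} d) _ = ⊑ₛ-≼ (go d refl) (≼-in-[] C)
  go (R⊥ d) eq = ⊑ₛ-≼ (go d eq) R⊥-≼
  go (Ex {C} d) eq = ⊑ₛ-≼ (go d eq) (Ex-≼ C)
  go (Ex⨾ {C} d) eq = ⊑ₛ-≼ (go d eq) (Ex⨾-≼ C)
  go (As₁ {C} d) eq = ⊑ₛ-≼ (go d eq) (As₁-≼ C)
  go (As₂ {C} d) eq = ⊑ₛ-≼ (go d eq) (As₂-≼ C)
  go (·R _ _) ()
  go (*R _ _) ()
  go (∖R _) ()
  go (⇒R _) ()
  go (∧R _ _) ()
  go (∨R₁ _) ()
  go (∨R₂ _) ()

SubSeq-⊑ : ∀ {Γ a c d} → c ⊑ d → SubSeq Γ a d → SubSeq Γ a c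
SubSeq-⊑ c⊑d (e , e∈ , d⊑e) = e , e∈ , ⊑-trans c⊑d d⊑e

SubSeq-antecedent : ∀ {Γ a c} → c ⊑ₛ Γ → SubSeq Γ a c
SubSeq-antecedent (d , d∈Γ , c⊑d) = d , inj₁ d∈Γ , c⊑d

SubSeq-∈ : ∀ {Γ a c} → c ∈ₛ Γ → SubSeq Γ a c
SubSeq-∈ c∈Γ = SubSeq-antecedent (∈ₛ⇒⊑ₛ c∈Γ)

SubSeq-succedent : ∀ {Γ a c} → c ⊑ a → SubSeq Γ a c
SubSeq-succedent {a = a} c⊑a = a , inj₂ refl , c⊑a

SubSeq-premise : ∀ {Γ' a' Γ a} → (∀ {d} → d ∈ₛ Γ' → SubSeq Γ a d) → SubSeq Γ a a' →
                 ∀ {c} → SubSeq Γ' a' c → SubSeq Γ a c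
SubSeq-premise ant _ (d , inj₁ d∈Γ' , c⊑d) = SubSeq-⊑ c⊑d (ant d∈Γ')
SubSeq-premise _ suc (_ , inj₂ refl , c⊑a') = SubSeq-⊑ c⊑a' suc

SubSeq-≼ : ∀ {Γ' Γ a} → Γ' ≼ Γ → ∀ {c} → SubSeq Γ' a c → SubSeq Γ a c
SubSeq-≼ Γ'≼Γ = SubSeq-premise (λ m → SubSeq-antecedent (Γ'≼Γ m)) (SubSeq-succedent ⊑-refl)

subformula-property : ∀ {Γ a} (d : CutFree Γ a) c → c ∈D embed d → SubSeq Γ a c
subformula-property (·L {C} d) c (·L-p p) = SubSeq-≼ (·L-≼ C) (subformula-property d c p)
subformula-property (*L {C} d) c (*L-p p) = SubSeq-≼ (*L-≼ C) (subformula-property d c p)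
subformula-property (·R d _) c (·R-1 p) =
  SubSeq-premise (λ m → SubSeq-∈ (,ₗ m)) (SubSeq-succedent (⊑·ₗ ⊑-refl)) (subformula-property d c p)
subformula-property (·R _ e) c (·R-2 p) =
  SubSeq-premise (λ m → SubSeq-∈ (,ᵣ m)) (SubSeq-succedent (⊑·ᵣ ⊑-refl)) (subformula-property e c p)
subformula-property (*R d _) c (*R-1 p) =
  SubSeq-premise (λ m → SubSeq-∈ (⨾ₗ m)) (SubSeq-succedent (⊑*ₗ ⊑-refl)) (subformula-property d c p)
subformula-property (*R _ e) c (*R-2 p) =
  SubSeq-premise (λ m → SubSeq-∈ (⨾ᵣ m)) (SubSeq-succedent (⊑*ᵣ ⊑-refl)) (subformula-property e c p)
subformula-property (∖L {C} d _) c (∖L-1 p) =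
  SubSeq-premise (λ m → SubSeq-∈ (∈ₛ-[] C (,ₗ m)))
    (SubSeq-antecedent (⊑ₛ-[] C (,ᵣ here) (⊑∖ₗ ⊑-refl))) (subformula-property d c p)
subformula-property (∖L {C} _ e) c (∖L-2 p) = SubSeq-≼ (∖L-≼ C) (subformula-property e c p)
subformula-property (⇒L {C} d _) c (⇒L-1 p) =
  SubSeq-premise (λ m → SubSeq-∈ (∈ₛ-[] C (⨾ₗ m)))
    (SubSeq-antecedent (⊑ₛ-[] C (⨾ᵣ here) (⊑⇒ₗ ⊑-refl))) (subformula-property d c p)
subformula-property (⇒L {C} _ e) c (⇒L-2 p) = SubSeq-≼ (⇒L-≼ C) (subformula-property e c p)
subformula-property (∖R d) c (∖R-p p) =
  SubSeq-premise (λ { (,ₗ here) → SubSeq-succedent (⊑∖ₗ ⊑-refl) ; (,ᵣ m) → SubSeq-∈ m })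
    (SubSeq-succedent (⊑∖ᵣ ⊑-refl)) (subformula-property d c p)
subformula-property (⇒R d) c (⇒R-p p) =
  SubSeq-premise (λ { (⨾ₗ here) → SubSeq-succedent (⊑⇒ₗ ⊑-refl) ; (⨾ᵣ m) → SubSeq-∈ m })
    (SubSeq-succedent (⊑⇒ᵣ ⊑-refl)) (subformula-property d c p)
subformula-property (∧L₁ {C} d) c (∧L₁-p p) = SubSeq-≼ (∧L₁-≼ C) (subformula-property d c p)
subformula-property (∧L₂ {C} d) c (∧L₂-p p) = SubSeq-≼ (∧L₂-≼ C) (subformula-property d c p)
subformula-property (∧R d _) c (∧R-1 p) =
  SubSeq-premise SubSeq-∈ (SubSeq-succedent (⊑∧ₗ ⊑-refl)) (subformula-property d c p)
subformula-property (∧R _ e) c (∧R-2 p) =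
  SubSeq-premise SubSeq-∈ (SubSeq-succedent (⊑∧ᵣ ⊑-refl)) (subformula-property e c p)
subformula-property (∨L {C} d _) c (∨L-1 p) = SubSeq-≼ (∨L₁-≼ C) (subformula-property d c p)
subformula-property (∨L {C} _ e) c (∨L-2 p) = SubSeq-≼ (∨L₂-≼ C) (subformula-property e c p)
subformula-property (∨R₁ d) c (∨R₁-p p) =
  SubSeq-premise SubSeq-∈ (SubSeq-succedent (⊑∨ₗ ⊑-refl)) (subformula-property d c p)
subformula-property (∨R₂ d) c (∨R₂-p p) =
  SubSeq-premise SubSeq-∈ (SubSeq-succedent (⊑∨ᵣ ⊑-refl)) (subformula-property d c p)
subformula-property (⊥R {C} d) c (⊥R-p p) =
  SubSeq-premise (λ m → SubSeq-∈ (∈ₛ-[] C m))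
    (SubSeq-antecedent (⊑ₛ-≼ (CutFree-⊥⊑ₛ d) (≼-in-[] C))) (subformula-property d c p)
subformula-property (R⊥ d) c (R⊥-p p) = SubSeq-≼ R⊥-≼ (subformula-property d c p)
subformula-property (Ex {C} d) c (Ex-p p) = SubSeq-≼ (Ex-≼ C) (subformula-property d c p)
subformula-property (Ex⨾ {C} d) c (Ex⨾-p p) = SubSeq-≼ (Ex⨾-≼ C) (subformula-property d c p)
subformula-property (As₁ {C} d) c (As₁-p p) = SubSeq-≼ (As₁-≼ C) (subformula-property d c p)
subformula-property (As₂ {C} d) c (As₂-p p) = SubSeq-≼ (As₂-≼ C) (subformula-property d c p)
subformula-property d c (root m) = c , m , ⊑-refl

corollary3 : (Γ : Str) (a : Fm) → ⊢Gb Γ a →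
    Σ (Gb Γ a) (λ d → ∀ c → c ∈D d → SubSeq Γ a c)
corollary3 Γ a d = embed (cut-elimination d) , subformula-property (cut-elimination d)
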